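{- Let $G$ be a graph with a $(k,\rho)$-geodesic-cover $\mathcal{P}$, and let $\ell\in\{0,\dots,k\}$. Suppose $C$ and $D$ are two $\ell$-simplified $\rho$-snappaths (w.r.t. $\mathcal{P}$) such that: $\mathrm{Start}(C)=\mathrm{Start}(D)$ and the first walk $R_0$ of both $C$ and $D$ has length $0$; $\mathrm{type}(C)=\mathrm{type}(D)$; $\big||C|-|D|\big|\le\gamma$ for some non-negative integer $\gamma$; and the concatenations of $C$ and $D$ are $\delta$-almost shortest walks, where $\delta=4k\rho+2\rho_\ell+2(k-k')\rho_\ell$ and $k'$ is the number of geodesics in $\mathrm{type}(C)$. Then $\mathrm{dist}(\mathrm{End}(C),\mathrm{End}(D))\le \gamma+k(4k\rho+2\rho_\ell+2k\rho_\ell)+k(4\rho_\ell)$.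
   Context: Graphs are finite, undirected and unweighted, with shortest-path distance $\mathrm{dist}$. A walk is a sequence of vertices with consecutive vertices adjacent; its length is its number of steps. A walk $W$ is $\delta$-almost shortest if $\big||W|-\mathrm{dist}(\mathrm{Start}(W),\mathrm{End}(W))\big|\le\delta$. A geodesic is a shortest path between its endpoints; each geodesic is considered with a fixed direction from its start to its end. A $(k,\rho)$-geodesic-cover of $G$ is a family $\mathcal{P}$ of $k$ geodesics such that every vertex is at distance at most $\rho$ from some vertex of a path in $\mathcal{P}$. Define $\rho_0=2\rho+1$ and $\rho_i=(2k+5)\rho_{i-1}$ for $i=1,\dots,k$. An $\ell$-simplified $\rho$-snappath is a sequence $(R_0,Q_1,R_1,\dots,Q_{k'},R_{k'})$ of walks with $\mathrm{End}(R_{i-1})=\mathrm{Start}(Q_i)$ and $\mathrm{End}(Q_i)=\mathrm{Start}(R_i)$ ($k'=0$ allowed), such that each $Q_i$ is a subpath of a geodesic in $\mathcal{P}$, each geodesic of $\mathcal{P}$ contains at most one $Q_i$ as a subpath, every $R_i$ has length at most $\rho_\ell$, and every $Q_i$ has length larger than $(2k+3)\rho_\ell$. Its length, start and end are those of the concatenation $R_0\cdot Q_1\cdots Q_{k'}\cdot R_{k'}$. Its type is the tuple $(\overline{P}_1,\dots,\overline{P}_{k'},\ell)$, where $P_i\in\mathcal{P}$ is the geodesic containing $Q_i$ and $\overline{P}_i$ records $P_i$ together with whether $Q_i$ traverses $P_i$ forwards (in the direction of $P_i$) or backwards. -}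

module Defs where

open import Data.Nat using (ℕ; zero; suc; _+_; _*_; _∸_; _≤_; _<_; ∣_-_∣)
open import Data.Fin using (Fin)
open import Data.Bool using (Bool; true; false; T)
open import Data.List using (List; []; _∷_; _++_; length; map; reverse)
open import Data.List.Membership.Propositional using (_∈_)
open import Data.List.Relation.Unary.Linked using (Linked)
open import Data.List.Relation.Unary.AllPairs using (AllPairs)
open import Data.List.Relation.Binary.Infix.Heterogeneous using (Infix)
open import Data.Product using (Σ; _×_; _,_; ∃)
open import Data.Sum using (_⊎_)
open import Data.Unit using (⊤)
open import Relation.Nullary using (¬_)
open import Relation.Binary.PropositionalEquality using (_≡_)

record Graph : Set where
  field
    n     : ℕ
    adj   : Fin n → Fin n → Bool
    sym   : ∀ u v → adj u v ≡ adj v u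
    irrefl : ∀ v → adj v v ≡ false

open Graph public

V : Graph → Set
V G = Fin (n G)

Adj : (G : Graph) → V G → V G → Set
Adj G u v = T (adj G u v)

record Walk (G : Graph) : Set where
  constructor walk
  field
    start : V G
    steps : List (V G)

open Walk public

module _ {G : Graph} where

  vertices : Walk G → List (V G)
  vertices W = start W ∷ steps W

  len : Walk G → ℕ
  len W = length (steps W)

  lastOf : V G → List (V G) → V G
  lastOf x []       = x
  lastOf x (y ∷ ys) = lastOf y ys

  end : Walk G → V G
  end W = lastOf (start W) (steps W)

  IsWalk : Walk G → Set
  IsWalk W = Linked (Adj G) (vertices W)

  IsDist : V G → V G → ℕ → Set
  IsDist u v d =
    (Σ (Walk G) λ W → IsWalk W × start W ≡ u × end W ≡ v × len W ≡ d)
    × (∀ W → IsWalk W → start W ≡ u → end W ≡ v → d ≤ len W)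

  IsGeodesic : Walk G → Set
  IsGeodesic P = IsWalk P × (∀ d → IsDist (start P) (end P) d → len P ≡ d)

  AlmostShortest : ℕ → Walk G → Set
  AlmostShortest δ W = ∀ d → IsDist (start W) (end W) d → ∣ len W - d ∣ ≤ δ

  SubpathDir : Bool → Walk G → Walk G → Set
  SubpathDir true  Q P = Infix _≡_ (vertices Q) (vertices P)
  SubpathDir false Q P = Infix _≡_ (reverse (vertices Q)) (vertices P)

  Subpath : Walk G → Walk G → Set
  Subpath Q P = SubpathDir true Q P ⊎ SubpathDir false Q P

IsGeodesicCover : (G : Graph) (k ρ : ℕ) → (Fin k → Walk G) → Set
IsGeodesicCover G k ρ P =
  (∀ i → IsGeodesic (P i)) ×
  (∀ (v : V G) → Σ (Fin k) λ i → Σ (V G) λ u →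
     u ∈ vertices (P i) × Σ ℕ λ d → IsDist {G} v u d × d ≤ ρ)

rhoSeq : ℕ → ℕ → ℕ → ℕ
rhoSeq k ρ zero    = 2 * ρ + 1
rhoSeq k ρ (suc i) = (2 * k + 5) * rhoSeq k ρ i

-- ℓ-simplified ρ-snappaths  (R₀, Q₁, R₁, …, Q_k', R_k')
-- stored as R₀ together with the list of segments (Q_i, R_i, P-index, direction)

record Segment (G : Graph) (k : ℕ) : Set where
  constructor seg
  field
    Q   : Walk G
    R   : Walk G
    idx : Fin k      -- which geodesic P_i of the cover contains Q_i
    fwd : Bool

open Segment public

record Snappath (G : Graph) (k : ℕ) : Set where
  constructor snap
  field
    R₀   : Walk G
    segs : List (Segment G k)

open Snappath public

module _ {G : Graph} {k : ℕ} where

  Chained : V G → List (Segment G k) → Set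
  Chained v []       = ⊤
  Chained v (s ∷ ss) = start (Q s) ≡ v × end (Q s) ≡ start (R s) × Chained (end (R s)) ss

  concatSteps : List (Segment G k) → List (V G)
  concatSteps []       = []
  concatSteps (s ∷ ss) = steps (Q s) ++ steps (R s) ++ concatSteps ss

  concatW : Snappath G k → Walk G
  concatW C = walk (start (R₀ C)) (steps (R₀ C) ++ concatSteps (segs C))

  numGeod : Snappath G k → ℕ
  numGeod C = length (segs C)

  -- type(C) without the ℓ component (ℓ is fixed in IsSnappath)
  typeOf : Snappath G k → List (Fin k × Bool)
  typeOf C = map (λ s → idx s , fwd s) (segs C)

IsSnappath : (G : Graph) (k ρ : ℕ) (P : Fin k → Walk G) (ℓ : ℕ) → Snappath G k → Set
IsSnappath G k ρ P ℓ C =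
  IsWalk (R₀ C) × len (R₀ C) ≤ ρℓ ×
  Chained (end (R₀ C)) (segs C) ×
  All′ (segs C) ×
  AllPairs (λ s s′ → ∀ p → ¬ (Subpath (Q s) (P p) × Subpath (Q s′) (P p))) (segs C)
  where
  ρℓ = rhoSeq k ρ ℓ
  All′ : List (Segment G k) → Set
  All′ []       = ⊤
  All′ (s ∷ ss) =
    (IsWalk (Q s) × IsWalk (R s) ×
     SubpathDir (fwd s) (Q s) (P (idx s)) ×
     len (R s) ≤ ρℓ × (2 * k + 3) * ρℓ < len (Q s)) × All′ ss

{-# OPTIONS --safe #-}
module Submission where

-- Walk C and D simultaneously from their common start s, one segment Qᵢ·Rᵢ at a time, keeping
-- track of the lengths TC, TD walked so far. Call the current positions c, d r-close if one of
-- them is reached from s through the other within its own walked length plus r. Both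
-- concatenations are δ-almost shortest, hence so are all their prefixes. When the two runners
-- traverse the same geodesic in the same direction, r-closeness survives: if the traversals
-- overlap, the runner behind can follow the one ahead; if they are disjoint, the runner behind
-- cannot be the one reached through the other, because its subpath is longer than (δ + r)/2.
-- Each Rᵢ costs at most 2ρ_ℓ of closeness. At the ends, r-closeness and ||C| − |D|| ≤ γ give
-- dist ≤ γ + r + δ, and r ≤ 2k′ρ_ℓ with k′ ≤ k, as each geodesic is used at most once.

open import Defs
open import Data.Nat using (ℕ; zero; suc; _+_; _*_; _∸_; _≤_; _<_; ∣_-_∣; z≤n; s≤s; _≤?_; NonZero)
open import Data.Nat.Properties
open import Data.Nat.Induction using (<-rec)
open import Data.Nat.Tactic.RingSolver using (solve-∀)
open import Data.Fin using (Fin) renaming (zero to fzero; suc to fsuc)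
open import Data.Fin.Properties using (any?; injective⇒≤; nonZeroIndex) renaming (_≟_ to _≟ᶠ_)
open import Data.Bool using (Bool; true; false; T)
open import Data.Bool.Properties using (T?)
open import Data.List using (List; []; _∷_; _++_; length; reverse; lookup)
open import Data.List.Properties using (length-++; length-map; unfold-reverse)
open import Data.List.Membership.Propositional.Properties using (∈-lookup)
open import Data.List.Relation.Unary.Linked using (Linked; []; [-]; _∷_)
open import Data.List.Relation.Unary.All as All using (All; []; _∷_)
open import Data.List.Relation.Unary.AllPairs using (AllPairs; []; _∷_)
open import Data.List.Relation.Unary.Unique.Propositional using (Unique)
import Data.List.Relation.Unary.AllPairs.Properties as AllPairs
open import Data.List.Relation.Binary.Infix.Heterogeneous using (Infix; here; there)
open import Data.List.Relation.Binary.Prefix.Heterogeneous using (Prefix; []; _∷_)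
open import Data.List.Relation.Binary.Pointwise as Pointwise using (Pointwise; []; _∷_)
open import Data.Product using (Σ; ∃; _×_; _,_; proj₂)
open import Data.Sum using (_⊎_; inj₁; inj₂; swap)
open import Data.Empty using (⊥-elim)
open import Function.Definitions using (Injective)
open import Relation.Nullary using (¬_; Dec; yes; no)
open import Relation.Nullary.Decidable using (_×-dec_; map′)
open import Relation.Unary using (Decidable)
open import Relation.Binary.PropositionalEquality as ≡ using (_≡_; _≢_; refl; cong; subst; subst₂)

least-witness : ∀ {P : ℕ → Set} → Decidable P → ∀ {m} → P m → Σ ℕ λ d → P d × (∀ {j} → P j → d ≤ j)
least-witness {P} P? = <-rec (λ m → P m → Least) search _
  where
  Least : Set
  Least = Σ ℕ λ d → P d × (∀ {j} → P j → d ≤ j)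
  search : ∀ m → (∀ {j} → j < m → P j → Least) → P m → Least
  search m smaller pm with anyUpTo? P? m
  ... | yes (j , j<m , pj) = smaller j<m pj
  ... | no  none           = m , pm , λ {j} pj → ≮⇒≥ λ j<m → none (j , j<m , pj)

m∸[n+o]+o≡m∸n : ∀ m n o → n + o ≤ m → m ∸ (n + o) + o ≡ m ∸ n
m∸[n+o]+o≡m∸n m n o n+o≤m = begin
  m ∸ (n + o) + o ≡⟨ cong (_+ o) (≡.sym (∸-+-assoc m n o)) ⟩
  m ∸ n ∸ o + o   ≡⟨ m∸n+n≡m (m+n≤o⇒m≤o∸n o (≤-trans (≤-reflexive (+-comm o n)) n+o≤m)) ⟩
  m ∸ n           ∎
  where open ≡.≡-Reasoning

lookup-injective : ∀ {A : Set} {xs : List A} → Unique xs → Injective _≡_ _≡_ (lookup xs)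
lookup-injective {xs = _ ∷ _} (_  ∷ _) {fzero}  {fzero}  _  = refl
lookup-injective {xs = _ ∷ _} (x≢ ∷ _) {fzero}  {fsuc j} eq = ⊥-elim (All.lookup x≢ (∈-lookup j) eq)
lookup-injective {xs = _ ∷ _} (x≢ ∷ _) {fsuc i} {fzero}  eq = ⊥-elim (All.lookup x≢ (∈-lookup i) (≡.sym eq))
lookup-injective {xs = _ ∷ _} (_  ∷ u) {fsuc i} {fsuc j} eq = cong fsuc (lookup-injective u eq)

module Walks {G : Graph} where

  record Reach (u v : V G) (m : ℕ) : Set where
    constructor reach
    field
      path    : Walk G
      isWalk  : IsWalk path
      start≡  : start path ≡ u
      end≡    : end path ≡ v
      length≤ : len path ≤ m

  reach-walk : ∀ {W u} → IsWalk W → start W ≡ u → Reach u (end W) (len W)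
  reach-walk {W} w start≡u = reach W w start≡u refl ≤-refl

  reach-refl : ∀ {u} → Reach u u 0
  reach-refl {u} = reach (walk u []) [-] refl refl z≤n

  reach-mono : ∀ {u v m m′} → m ≤ m′ → Reach u v m → Reach u v m′
  reach-mono m≤m′ (reach W w s e l) = reach W w s e (≤-trans l m≤m′)

  reach-edge : ∀ {u v} → Adj G u v → Reach u v 1
  reach-edge {u} {v} uv = reach (walk u (v ∷ [])) (uv ∷ [-]) refl refl ≤-refl

  lastOf-++ : ∀ (x : V G) xs ys → lastOf {G} x (xs ++ ys) ≡ lastOf {G} (lastOf {G} x xs) ys
  lastOf-++ x []       ys = refl
  lastOf-++ x (y ∷ xs) ys = lastOf-++ y xs ys

  linked-++ : ∀ {x : V G} xs {ys} → Linked (Adj G) (x ∷ xs) →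
              Linked (Adj G) (lastOf {G} x xs ∷ ys) → Linked (Adj G) (x ∷ xs ++ ys)
  linked-++ []       _          l₂ = l₂
  linked-++ (_ ∷ xs) (xy ∷ l₁) l₂ = xy ∷ linked-++ xs l₁ l₂

  reach-trans : ∀ {u v w m m′} → Reach u v m → Reach v w m′ → Reach u w (m + m′)
  reach-trans (reach (walk a xs) wx refl refl lx) (reach (walk _ ys) wy refl refl ly) =
    reach (walk a (xs ++ ys)) (linked-++ xs wx wy) refl (lastOf-++ a xs ys)
          (≤-trans (≤-reflexive (length-++ xs)) (+-mono-≤ lx ly))

  reach-backwards : ∀ x xs → Linked (Adj G) (x ∷ xs) → Reach (lastOf {G} x xs) x (length xs)
  reach-backwards x []       _         = reach-refl
  reach-backwards x (y ∷ ys) (xy ∷ l) =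
    reach-mono (≤-reflexive (+-comm (length ys) 1))
      (reach-trans (reach-backwards y ys l) (reach-edge (subst T (Graph.sym G x y) xy)))

  reach-sym : ∀ {u v m} → Reach u v m → Reach v u m
  reach-sym (reach (walk a xs) w refl refl l) = reach-mono l (reach-backwards a xs w)

  WalkOfLength : V G → V G → ℕ → Set
  WalkOfLength u v m = Σ (Walk G) λ W → IsWalk W × start W ≡ u × end W ≡ v × len W ≡ m

  walkOfLength? : ∀ m u v → Dec (WalkOfLength u v m)
  walkOfLength? zero u v = map′ stay halt (u ≟ᶠ v)
    where
    stay : u ≡ v → WalkOfLength u v zero
    stay u≡v = walk u [] , [-] , refl , u≡v , refl
    halt : WalkOfLength u v zero → u ≡ v
    halt (walk _ [] , _ , refl , u≡v , _) = u≡v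
  walkOfLength? (suc m) u v =
    map′ extend split (any? λ w → T? (adj G u w) ×-dec walkOfLength? m w v)
    where
    extend : (∃ λ w → Adj G u w × WalkOfLength w v m) → WalkOfLength u v (suc m)
    extend (w , uw , walk _ ys , l , refl , e , refl) = walk u (w ∷ ys) , uw ∷ l , refl , e , refl
    split : WalkOfLength u v (suc m) → ∃ λ w → Adj G u w × WalkOfLength w v m
    split (walk _ (w ∷ ys) , uw ∷ l , refl , e , eq) = w , uw , walk w ys , l , refl , e , suc-injective eq

  dist-exists : ∀ {u v m} → Reach u v m → Σ ℕ λ d → IsDist u v d × d ≤ m
  dist-exists {u} {v} (reach W w s e l) with least-witness (λ m → walkOfLength? m u v) (W , w , s , e , refl)
  ... | d , shortest , minimal =
    d , (shortest , λ W′ w′ s′ e′ → minimal (W′ , w′ , s′ , e′ , refl)) , ≤-trans (minimal (W , w , s , e , refl)) l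

  dist-≤ : ∀ {u v d m} → IsDist u v d → Reach u v m → d ≤ m
  dist-≤ (_ , minimal) (reach W w s e l) = ≤-trans (minimal W w s e) l

  geodesic-shortest : ∀ {W m} → IsGeodesic W → Reach (start W) (end W) m → len W ≤ m
  geodesic-shortest (_ , isShortest) r with dist-exists r
  ... | d , isDist , d≤m = ≤-trans (≤-reflexive (isShortest d isDist)) d≤m

  -- An isometric copy of the interval [0, size] in G.
  record Line : Set where
    field
      size  : ℕ
      point : ℕ → V G
      along : ∀ {i t j} → i + t ≡ j → j ≤ size → Reach (point i) (point j) t
      tight : ∀ {i t j e} → i + t ≡ j → j ≤ size → Reach (point i) (point j) e → t ≤ e

  open Line

  -- Indices past the end give the last vertex, so reach-vertexAt needs no bound on i + t.
  vertexAt : V G → List (V G) → ℕ → V G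
  vertexAt x []       _       = x
  vertexAt x (y ∷ ys) zero    = x
  vertexAt x (y ∷ ys) (suc i) = vertexAt y ys i

  vertexAt-zero : ∀ x xs → vertexAt x xs 0 ≡ x
  vertexAt-zero x []      = refl
  vertexAt-zero x (_ ∷ _) = refl

  vertexAt-length : ∀ x xs → vertexAt x xs (length xs) ≡ lastOf {G} x xs
  vertexAt-length x []       = refl
  vertexAt-length x (y ∷ ys) = vertexAt-length y ys

  reach-vertexAt-from-start : ∀ {x xs} → Linked (Adj G) (x ∷ xs) → ∀ t → Reach x (vertexAt x xs t) t
  reach-vertexAt-from-start {xs = []}    _         t       = reach-mono z≤n reach-refl
  reach-vertexAt-from-start {xs = _ ∷ _} _         zero    = reach-refl
  reach-vertexAt-from-start {xs = _ ∷ _} (xy ∷ l) (suc t) = reach-trans (reach-edge xy) (reach-vertexAt-from-start l t)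

  reach-vertexAt : ∀ {x xs} → Linked (Adj G) (x ∷ xs) → ∀ i t → Reach (vertexAt x xs i) (vertexAt x xs (i + t)) t
  reach-vertexAt {xs = []}    _        i       t = reach-mono z≤n reach-refl
  reach-vertexAt {xs = _ ∷ _} l        zero    t = reach-vertexAt-from-start l t
  reach-vertexAt {xs = _ ∷ _} (_ ∷ l) (suc i) t = reach-vertexAt l i t

  geodesic-line : (W : Walk G) → IsGeodesic W → Line
  geodesic-line W geo@(w , _) = record
    { size  = len W
    ; point = vertexAt (start W) (steps W)
    ; along = λ { {i} {t} refl _ → reach-vertexAt w i t }
    ; tight = tight′
    }
    where
    tight′ : ∀ {i t j e} → i + t ≡ j → j ≤ len W →
             Reach (vertexAt (start W) (steps W) i) (vertexAt (start W) (steps W) j) e → t ≤ e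
    tight′ {i} {t} {j} {e} refl j≤N middle =
      +-cancelˡ-≤ i t e (+-cancelʳ-≤ rest (i + t) (i + e) (≤-trans (≤-reflexive (m+[n∸m]≡n j≤N)) detour))
      where
      rest : ℕ
      rest = len W ∸ j
      toEnd : Reach (vertexAt (start W) (steps W) j) (end W) rest
      toEnd = subst (λ v → Reach (vertexAt (start W) (steps W) j) v rest)
                    (≡.trans (cong (vertexAt (start W) (steps W)) (m+[n∸m]≡n j≤N)) (vertexAt-length (start W) (steps W)))
                    (reach-vertexAt w j rest)
      detour : len W ≤ i + e + rest
      detour = geodesic-shortest geo (reach-trans (reach-trans (reach-vertexAt-from-start w i) middle) toEnd)

  reverse-line : Line → Line
  reverse-line L = record
    { size  = size L
    ; point = λ i → point L (size L ∸ i)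
    ; along = λ { {i} {t} refl j≤N → reach-sym (along L (m∸[n+o]+o≡m∸n (size L) i t j≤N) (m∸n≤m (size L) i)) }
    ; tight = λ { {i} {t} refl j≤N r → tight L (m∸[n+o]+o≡m∸n (size L) i t j≤N) (m∸n≤m (size L) i) (reach-sym r) }
    }

  record Occurs (L : Line) (W : Walk G) : Set where
    constructor occurs
    field
      offset  : ℕ
      first≡  : point L offset ≡ start W
      last≡   : point L (offset + len W) ≡ end W
      fits    : offset + len W ≤ size L

  prefix-vertexAt : ∀ {x y : V G} {xs ys} → Prefix _≡_ (x ∷ xs) (y ∷ ys) →
                    vertexAt y ys (length xs) ≡ lastOf {G} x xs × length xs ≤ length ys
  prefix-vertexAt {x} {ys = ys} (refl ∷ []) = vertexAt-zero x ys , z≤n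
  prefix-vertexAt (refl ∷ (e ∷ rest)) with prefix-vertexAt (e ∷ rest)
  ... | at-last , fits = at-last , s≤s fits

  infix-vertexAt : ∀ {x y : V G} {xs ys} → Infix _≡_ (x ∷ xs) (y ∷ ys) →
    Σ ℕ λ p → vertexAt y ys p ≡ x × vertexAt y ys (p + length xs) ≡ lastOf {G} x xs × p + length xs ≤ length ys
  infix-vertexAt {y = y} {ys = ys} (here p@(refl ∷ _)) = 0 , vertexAt-zero y ys , prefix-vertexAt p
  infix-vertexAt {ys = _ ∷ _} (there inf) with p , first , last , fits ← infix-vertexAt inf =
    suc p , first , last , s≤s fits
  infix-vertexAt {ys = []} (there (here ()))

  occurs-forwards : ∀ {W} (geo : IsGeodesic W) {U} → SubpathDir true U W → Occurs (geodesic-line W geo) U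
  occurs-forwards {walk _ _} _ {walk _ _} inf with p , first , last , fits ← infix-vertexAt inf =
    occurs p first last fits

  reverse-vertices : ∀ (x : V G) xs → Σ (List (V G)) λ zs →
    reverse (x ∷ xs) ≡ lastOf {G} x xs ∷ zs × lastOf {G} (lastOf {G} x xs) zs ≡ x × length zs ≡ length xs
  reverse-vertices x []       = [] , refl , refl , refl
  reverse-vertices x (y ∷ ys) with zs , rev≡ , last≡ , length≡ ← reverse-vertices y ys =
    zs ++ x ∷ [] ,
    ≡.trans (unfold-reverse x (y ∷ ys)) (cong (_++ x ∷ []) rev≡) ,
    lastOf-++ (lastOf {G} y ys) zs (x ∷ []) ,
    ≡.trans (length-++ zs) (≡.trans (+-comm (length zs) 1) (cong suc length≡))

  occurs-reverse-line : ∀ (L : Line) {U : Walk G} p → point L p ≡ end U → point L (p + len U) ≡ start U →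
                        p + len U ≤ size L → Occurs (reverse-line L) U
  occurs-reverse-line L {U} p p≡end p+len≡start fits = occurs (size L ∸ (p + len U)) first last fits′
    where
    shift : size L ∸ (p + len U) + len U ≡ size L ∸ p
    shift = m∸[n+o]+o≡m∸n (size L) p (len U) fits
    first : point L (size L ∸ (size L ∸ (p + len U))) ≡ start U
    first = ≡.trans (cong (point L) (m∸[m∸n]≡n fits)) p+len≡start
    last : point L (size L ∸ (size L ∸ (p + len U) + len U)) ≡ end U
    last = ≡.trans (cong (λ i → point L (size L ∸ i)) shift)
                   (≡.trans (cong (point L) (m∸[m∸n]≡n (m+n≤o⇒m≤o p fits))) p≡end)
    fits′ : size L ∸ (p + len U) + len U ≤ size L
    fits′ = ≤-trans (≤-reflexive shift) (m∸n≤m (size L) p)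

  occurs-backwards : ∀ {W} (geo : IsGeodesic W) {U} → SubpathDir false U W →
                     Occurs (reverse-line (geodesic-line W geo)) U
  occurs-backwards {walk y ys} geo {walk x xs} inf
    with zs , rev≡ , last≡ , length≡ ← reverse-vertices x xs
    with p , first , last , fits ← infix-vertexAt (subst (λ vs → Infix _≡_ vs (y ∷ ys)) rev≡ inf) =
    occurs-reverse-line (geodesic-line (walk y ys) geo) p first
      (≡.trans (subst (λ A → vertexAt y ys (p + A) ≡ lastOf {G} (lastOf {G} x xs) zs) length≡ last) last≡)
      (subst (λ A → p + A ≤ length ys) length≡ fits)

  directed-line : Bool → (W : Walk G) → IsGeodesic W → Line
  directed-line true  W geo = geodesic-line W geo
  directed-line false W geo = reverse-line (geodesic-line W geo)

  occurs-directed : ∀ b {W} (geo : IsGeodesic W) {U} → SubpathDir b U W → Occurs (directed-line b W geo) U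
  occurs-directed true  = occurs-forwards
  occurs-directed false = occurs-backwards

module Runners {G : Graph} (s : V G) (δ : ℕ) where

  open Walks {G}

  AlmostShortestTo : V G → ℕ → Set
  AlmostShortestTo v T = ∀ {m} → Reach s v m → T ≤ m + δ

  almostShortest⇒To : ∀ {W} → start W ≡ s → AlmostShortest δ W → AlmostShortestTo (end W) (len W)
  almostShortest⇒To {W} refl almost r with d , isDist , d≤m ← dist-exists r =
    ≤-trans (m≤n+∣m-n∣ (len W) d) (+-mono-≤ d≤m (almost d isDist))

  almostShortestTo-mono : ∀ {v T T′} → T′ ≤ T → AlmostShortestTo v T → AlmostShortestTo v T′
  almostShortestTo-mono T′≤T ast r = ≤-trans T′≤T (ast r)

  almostShortestTo-back : ∀ {v w T e} → AlmostShortestTo w (T + e) → Reach v w e → AlmostShortestTo v T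
  almostShortestTo-back {T = T} {e} ast vw {m} r =
    +-cancelʳ-≤ e T (m + δ) (≤-trans (ast (reach-trans r vw)) (≤-reflexive (shuffle m e δ)))
    where
    shuffle : ∀ m e δ → m + e + δ ≡ m + δ + e
    shuffle = solve-∀

  record Via (d c : V G) (m : ℕ) : Set where
    constructor via
    field
      {e₁ e₂} : ℕ
      to-d    : Reach s d e₁
      d-to-c  : Reach d c e₂
      bound   : e₁ + e₂ ≤ m

  via-mono : ∀ {d c m m′} → m ≤ m′ → Via d c m → Via d c m′
  via-mono m≤m′ (via sd dc bound) = via sd dc (≤-trans bound m≤m′)

  -- TC and TD are the lengths walked from s by the runners now at c and d.
  Close : V G → V G → ℕ → ℕ → ℕ → Set
  Close c d TC TD r = Via d c (TC + r) ⊎ Via c d (TD + r)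

  close-mono : ∀ {c d TC TC′ TD TD′ r r′} → TC ≤ TC′ → TD ≤ TD′ → r ≤ r′ →
               Close c d TC TD r → Close c d TC′ TD′ r′
  close-mono TC≤ _   r≤ (inj₁ v) = inj₁ (via-mono (+-mono-≤ TC≤ r≤) v)
  close-mono _   TD≤ r≤ (inj₂ v) = inj₂ (via-mono (+-mono-≤ TD≤ r≤) v)

  via-detour : ∀ {c c′ d d′ m x y} → Via d c m → Reach c c′ x → Reach d d′ y → Via d′ c′ (m + x + (y + y))
  via-detour {m = m} {x} {y} (via {e₁} {e₂} sd dc bound) cc′ dd′ =
    via (reach-trans sd dd′) (reach-trans (reach-trans (reach-sym dd′) dc) cc′)
        (≤-trans (≤-reflexive (shuffle e₁ e₂ x y)) (+-monoˡ-≤ (y + y) (+-monoˡ-≤ x bound)))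
    where
    shuffle : ∀ e₁ e₂ x y → e₁ + y + (y + e₂ + x) ≡ e₁ + e₂ + x + (y + y)
    shuffle = solve-∀

  detour-bound : ∀ T r x {y z} → y ≤ z → T + r + x + (y + y) ≤ T + x + (r + 2 * z)
  detour-bound T r x {y} y≤z =
    ≤-trans (≤-reflexive (shuffle T r x y)) (+-monoʳ-≤ (T + x) (+-monoʳ-≤ r (*-monoʳ-≤ 2 y≤z)))
    where
    shuffle : ∀ T r x y → T + r + x + (y + y) ≡ T + x + (r + 2 * y)
    shuffle = solve-∀

  close-detour : ∀ {c c′ d d′ TC TD r x y z} → x ≤ z → y ≤ z → Reach c c′ x → Reach d d′ y →
                 Close c d TC TD r → Close c′ d′ (TC + x) (TD + y) (r + 2 * z)
  close-detour {TC = TC} {TD} {r} {x} {y} x≤z y≤z cc′ dd′ (inj₁ v) =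
    inj₁ (via-mono (detour-bound TC r x y≤z) (via-detour v cc′ dd′))
  close-detour {TC = TC} {TD} {r} {x} {y} x≤z y≤z cc′ dd′ (inj₂ v) =
    inj₂ (via-mono (detour-bound TD r y x≤z) (via-detour v dd′ cc′))

  via-short : ∀ {c d T T′ r γ} → Via d c (T + r) → AlmostShortestTo d T′ → T ≤ T′ + γ → Reach d c (γ + r + δ)
  via-short {T = T} {T′} {r} {γ} (via {e₁} {e₂} sd dc bound) ast T≤T′+γ =
    reach-mono (+-cancelˡ-≤ e₁ e₂ (γ + r + δ) e₁+e₂≤) dc
    where
    open ≤-Reasoning
    shuffle : ∀ e₁ δ γ r → e₁ + δ + γ + r ≡ e₁ + (γ + r + δ)
    shuffle = solve-∀
    e₁+e₂≤ : e₁ + e₂ ≤ e₁ + (γ + r + δ)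
    e₁+e₂≤ = begin
      e₁ + e₂        ≤⟨ bound ⟩
      T + r          ≤⟨ +-monoˡ-≤ r T≤T′+γ ⟩
      T′ + γ + r     ≤⟨ +-monoˡ-≤ r (+-monoˡ-≤ γ (ast sd)) ⟩
      e₁ + δ + γ + r ≡⟨ shuffle e₁ δ γ r ⟩
      e₁ + (γ + r + δ) ∎

  close-short : ∀ {c d TC TD r γ} → Close c d TC TD r → AlmostShortestTo c TC → AlmostShortestTo d TD →
                ∣ TC - TD ∣ ≤ γ → Reach c d (γ + r + δ)
  close-short {TC = TC} {TD} (inj₁ v) _ astD diff =
    reach-sym (via-short v astD (≤-trans (m≤n+∣m-n∣ TC TD) (+-monoʳ-≤ TD diff)))
  close-short {TC = TC} {TD} (inj₂ v) astC _ diff =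
    via-short v astC (≤-trans (m≤n+∣n-m∣ TD TC) (+-monoʳ-≤ TC diff))

  -- One runner moves along L from p to x = p + a, the other from q to y = q + b.
  module _ (L : Line) where

    open Line L

    via-overlapping : ∀ {p a q b u w TD} → q + u ≡ p + a → p + a + w ≡ q + b → q + b ≤ size →
                      Reach s (point q) TD → Via (point (p + a)) (point (q + b)) (TD + b)
    via-overlapping {p} {a} {q} {b} {u} {w} {TD} q+u≡x x+w≡y y≤N sq =
      via (reach-trans sq (along q+u≡x x≤N)) (along x+w≡y y≤N)
          (≤-reflexive (≡.trans (+-assoc TD u w) (cong (TD +_) u+w≡b)))
      where
      x≤N : p + a ≤ size
      x≤N = m+n≤o⇒m≤o (p + a) (≤-trans (≤-reflexive x+w≡y) y≤N)
      u+w≡b : u + w ≡ b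
      u+w≡b = +-cancelˡ-≡ q (u + w) b (≡.trans (≡.sym (+-assoc q u w)) (≡.trans (cong (_+ w) q+u≡x) x+w≡y))

    -- Going s ⇝ q and back to p + a is at least a + a shorter than s ⇝ q ⇝ p followed by the run from p
    -- to p + a, and almost-shortestness at p + a forbids saving more than δ + r.
    via-ahead-bound : ∀ {p a g q TC r} → p + a + g ≡ q → q ≤ size → Via (point q) (point p) (TC + r) →
                      AlmostShortestTo (point (p + a)) (TC + a) → a + a ≤ δ + r
    via-ahead-bound {p} {a} {g} {q} {TC} {r} x+g≡q q≤N (via {e₁} {e₂} sq qp bound) ast =
      +-cancelˡ-≤ TC (a + a) (δ + r) (+-cancelʳ-≤ g (TC + (a + a)) (TC + (δ + r)) chain)
      where
      open ≤-Reasoning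
      a+g≤e₂ : a + g ≤ e₂
      a+g≤e₂ = tight (≡.trans (≡.sym (+-assoc p a g)) x+g≡q) q≤N (reach-sym qp)
      TC+a≤ : TC + a ≤ e₁ + g + δ
      TC+a≤ = ast (reach-trans sq (reach-sym (along x+g≡q q≤N)))
      shuffle₁ : ∀ T a g → T + (a + a) + g ≡ T + a + (a + g)
      shuffle₁ = solve-∀
      shuffle₂ : ∀ e₁ g δ e₂ → e₁ + g + δ + e₂ ≡ e₁ + e₂ + (δ + g)
      shuffle₂ = solve-∀
      shuffle₃ : ∀ T r δ g → T + r + (δ + g) ≡ T + (δ + r) + g
      shuffle₃ = solve-∀
      chain : TC + (a + a) + g ≤ TC + (δ + r) + g
      chain = begin
        TC + (a + a) + g       ≡⟨ shuffle₁ TC a g ⟩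
        TC + a + (a + g)       ≤⟨ +-mono-≤ TC+a≤ a+g≤e₂ ⟩
        e₁ + g + δ + e₂        ≡⟨ shuffle₂ e₁ g δ e₂ ⟩
        e₁ + e₂ + (δ + g)      ≤⟨ +-monoˡ-≤ (δ + g) bound ⟩
        TC + r + (δ + g)       ≡⟨ shuffle₃ TC r δ g ⟩
        TC + (δ + r) + g       ∎

    via-behind : ∀ {p a g q b TD r} → p + a + g ≡ q → q + b ≤ size → Via (point p) (point q) (TD + r) →
                 Via (point (p + a)) (point (q + b)) (TD + b + r)
    via-behind {p} {a} {g} {q} {b} {TD} {r} x+g≡q y≤N (via {e₁} {e₂} sp pq bound) =
      via (reach-trans sp (along refl x≤N)) (along x+[g+b]≡y y≤N) length≤
      where
      open ≤-Reasoning
      q≤N : q ≤ size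
      q≤N = m+n≤o⇒m≤o q y≤N
      x≤N : p + a ≤ size
      x≤N = m+n≤o⇒m≤o (p + a) (≤-trans (≤-reflexive x+g≡q) q≤N)
      x+[g+b]≡y : p + a + (g + b) ≡ q + b
      x+[g+b]≡y = ≡.trans (≡.sym (+-assoc (p + a) g b)) (cong (_+ b) x+g≡q)
      a+g≤e₂ : a + g ≤ e₂
      a+g≤e₂ = tight (≡.trans (≡.sym (+-assoc p a g)) x+g≡q) q≤N pq
      shuffle₁ : ∀ e₁ a g b → e₁ + a + (g + b) ≡ e₁ + (a + g) + b
      shuffle₁ = solve-∀
      shuffle₂ : ∀ T r b → T + r + b ≡ T + b + r
      shuffle₂ = solve-∀
      length≤ : e₁ + a + (g + b) ≤ TD + b + r
      length≤ = begin
        e₁ + a + (g + b) ≡⟨ shuffle₁ e₁ a g b ⟩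
        e₁ + (a + g) + b ≤⟨ +-monoˡ-≤ b (+-monoʳ-≤ e₁ a+g≤e₂) ⟩
        e₁ + e₂ + b      ≤⟨ +-monoˡ-≤ b bound ⟩
        TD + r + b       ≡⟨ shuffle₂ TD r b ⟩
        TD + b + r       ∎

    close-along-≤ : ∀ {p a q b TC TD r} → p + a ≤ q + b → q + b ≤ size → Reach s (point q) TD →
                    AlmostShortestTo (point (p + a)) (TC + a) → δ + r < a + a →
                    Close (point p) (point q) TC TD r → Close (point (p + a)) (point (q + b)) (TC + a) (TD + b) r
    close-along-≤ {p} {a} {q} {b} {TC} {TD} {r} x≤y y≤N sq ast slack close with q ≤? p + a
    ... | yes q≤x =
      inj₂ (via-mono (m≤m+n (TD + b) r)
                     (via-overlapping {p} {a} (proj₂ (m≤n⇒∃[o]m+o≡n q≤x)) (proj₂ (m≤n⇒∃[o]m+o≡n x≤y)) y≤N sq))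
    ... | no q≰x with close | m≤n⇒∃[o]m+o≡n (<⇒≤ (≰⇒> q≰x))
    ...   | inj₁ v | _ , x+g≡q = ⊥-elim (<⇒≱ slack (via-ahead-bound x+g≡q (m+n≤o⇒m≤o q y≤N) v ast))
    ...   | inj₂ v | _ , x+g≡q = inj₂ (via-behind {TD = TD} {r} x+g≡q y≤N v)

    close-along : ∀ {p a q b c c′ d d′ TC TD r} →
                  point p ≡ c → point (p + a) ≡ c′ → point q ≡ d → point (q + b) ≡ d′ →
                  p + a ≤ size → q + b ≤ size → Reach s c TC → Reach s d TD →
                  AlmostShortestTo c′ (TC + a) → AlmostShortestTo d′ (TD + b) → δ + r < a + a → δ + r < b + b →
                  Close c d TC TD r → Close c′ d′ (TC + a) (TD + b) r
    close-along {p} {a} {q} {b} refl refl refl refl x≤N y≤N sp sq astC astD slackC slackD close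
      with p + a ≤? q + b
    ... | yes x≤y = close-along-≤ x≤y y≤N sq astC slackC close
    ... | no  x≰y = swap (close-along-≤ (<⇒≤ (≰⇒> x≰y)) x≤N sp astD slackD (swap close))

record WellFormed {G : Graph} {k : ℕ} (P : Fin k → Walk G) (z Λ : ℕ) (x : Segment G k) : Set where
  constructor wellFormed
  field
    Q-walk  : IsWalk (Q x)
    R-walk  : IsWalk (R x)
    Q-on-P  : SubpathDir (fwd x) (Q x) (P (idx x))
    R-short : len (R x) ≤ z
    Q-long  : Λ < len (Q x)

SameType : ∀ {G k} → Segment G k → Segment G k → Set
SameType x y = (idx x , fwd x) ≡ (idx y , fwd y)

module Traversal {G : Graph} {k : ℕ} (P : Fin k → Walk G) (geodesic : ∀ i → IsGeodesic (P i))
                 (z Λ : ℕ) (s : V G) (δ : ℕ) where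

  open Walks {G}
  open Runners {G} s δ

  chainEnd : V G → List (Segment G k) → V G
  chainEnd v []       = v
  chainEnd v (x ∷ xs) = chainEnd (end (R x)) xs

  concatLength : List (Segment G k) → ℕ
  concatLength xs = length (concatSteps xs)

  concatLength-∷ : ∀ T x xs → T + len (Q x) + len (R x) + concatLength xs ≡ T + concatLength (x ∷ xs)
  concatLength-∷ T x xs = begin
    T + len (Q x) + len (R x) + concatLength xs   ≡⟨ shuffle T (len (Q x)) (len (R x)) (concatLength xs) ⟩
    T + (len (Q x) + (len (R x) + concatLength xs)) ≡⟨ cong (λ n → T + (len (Q x) + n)) (≡.sym (length-++ (steps (R x)))) ⟩
    T + (len (Q x) + length (steps (R x) ++ concatSteps xs)) ≡⟨ cong (T +_) (≡.sym (length-++ (steps (Q x)))) ⟩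
    T + concatLength (x ∷ xs) ∎
    where
    open ≡.≡-Reasoning
    shuffle : ∀ T q r l → T + q + r + l ≡ T + (q + (r + l))
    shuffle = solve-∀

  lastOf-concatSteps : ∀ v xs → Chained v xs → lastOf {G} v (concatSteps xs) ≡ chainEnd v xs
  lastOf-concatSteps v []       _ = refl
  lastOf-concatSteps v (x ∷ xs) (refl , Q→R , chained) = begin
    lastOf {G} (start (Q x)) (steps (Q x) ++ steps (R x) ++ concatSteps xs)
      ≡⟨ lastOf-++ (start (Q x)) (steps (Q x)) _ ⟩
    lastOf {G} (end (Q x)) (steps (R x) ++ concatSteps xs)
      ≡⟨ cong (λ u → lastOf {G} u (steps (R x) ++ concatSteps xs)) Q→R ⟩
    lastOf {G} (start (R x)) (steps (R x) ++ concatSteps xs)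
      ≡⟨ lastOf-++ (start (R x)) (steps (R x)) _ ⟩
    lastOf {G} (end (R x)) (concatSteps xs)
      ≡⟨ lastOf-concatSteps (end (R x)) xs chained ⟩
    chainEnd (end (R x)) xs ∎
    where open ≡.≡-Reasoning

  reach-chainEnd : ∀ {v xs} → Chained v xs → All (WellFormed P z Λ) xs → Reach v (chainEnd v xs) (concatLength xs)
  reach-chainEnd {xs = []}     _                    _  = reach-refl
  reach-chainEnd {v} {x ∷ xs} (Q≡ , Q→R , chained) (wellFormed Qw Rw _ _ _ ∷ wfs) =
    reach-mono (≤-reflexive (concatLength-∷ 0 x xs))
      (reach-trans (reach-trans (reach-walk Qw Q≡) (reach-walk Rw (≡.sym Q→R))) (reach-chainEnd chained wfs))

  record Runner (c : V G) (T : ℕ) (xs : List (Segment G k)) : Set where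
    constructor runner
    field
      chained       : Chained c xs
      allWellFormed : All (WellFormed P z Λ) xs
      route         : Reach s c T
      finish        : AlmostShortestTo (chainEnd c xs) (T + concatLength xs)

  runner-next : ∀ {c T x xs} → Runner c T (x ∷ xs) → Runner (end (R x)) (T + len (Q x) + len (R x)) xs
  runner-next {T = T} {x} {xs} (runner (Q≡ , Q→R , chained) (wellFormed Qw Rw _ _ _ ∷ wfs) route finish) =
    runner chained wfs
      (reach-trans (reach-trans route (reach-walk Qw Q≡)) (reach-walk Rw (≡.sym Q→R)))
      (almostShortestTo-mono (≤-reflexive (concatLength-∷ T x xs)) finish)

  runner-end-of-Q : ∀ {c T x xs} → Runner c T (x ∷ xs) → AlmostShortestTo (end (Q x)) (T + len (Q x))
  runner-end-of-Q {T = T} {x} {xs} (runner (_ , Q→R , chained) (wellFormed _ Rw _ _ _ ∷ wfs) _ finish) =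
    almostShortestTo-back (almostShortestTo-mono (≤-reflexive regroup) finish)
      (reach-trans (reach-walk Rw (≡.sym Q→R)) (reach-chainEnd chained wfs))
    where
    regroup : T + len (Q x) + (len (R x) + concatLength xs) ≡ T + concatLength (x ∷ xs)
    regroup = ≡.trans (≡.sym (+-assoc (T + len (Q x)) (len (R x)) (concatLength xs))) (concatLength-∷ T x xs)

  close-across : ∀ {c d TC TD r Q₁ R₁ Q₂ R₂ i b xs ys} →
                 Runner c TC (seg Q₁ R₁ i b ∷ xs) → Runner d TD (seg Q₂ R₂ i b ∷ ys) → δ + r ≤ Λ + Λ →
                 Close c d TC TD r → Close (end R₁) (end R₂) (TC + len Q₁ + len R₁) (TD + len Q₂ + len R₂) (r + 2 * z)
  close-across {TC = TC} {TD} {r} {Q₁} {Q₂ = Q₂} {i = i} {b}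
    runC@(runner (Q₁≡ , Q₁→R₁ , _) (wellFormed _ R₁w Q₁-on-P R₁-short Q₁-long ∷ _) routeC _)
    runD@(runner (Q₂≡ , Q₂→R₂ , _) (wellFormed _ R₂w Q₂-on-P R₂-short Q₂-long ∷ _) routeD _) slack close
    with occurs p first₁ last₁ fits₁ ← occurs-directed b (geodesic i) Q₁-on-P
       | occurs q first₂ last₂ fits₂ ← occurs-directed b (geodesic i) Q₂-on-P =
    close-detour {TC = TC + len Q₁} {TD + len Q₂} {r} R₁-short R₂-short
      (reach-walk R₁w (≡.sym Q₁→R₁)) (reach-walk R₂w (≡.sym Q₂→R₂))
      (close-along (directed-line b (P i) (geodesic i))
        (≡.trans first₁ Q₁≡) last₁ (≡.trans first₂ Q₂≡) last₂ fits₁ fits₂ routeC routeD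
        (runner-end-of-Q runC) (runner-end-of-Q runD)
        (≤-<-trans slack (+-mono-< Q₁-long Q₁-long)) (≤-<-trans slack (+-mono-< Q₂-long Q₂-long)) close)

  close-at-ends : ∀ {c d TC TD r xs ys} → Pointwise SameType xs ys → Runner c TC xs → Runner d TD ys →
                  δ + (r + length xs * (2 * z)) ≤ Λ + Λ → Close c d TC TD r →
                  Close (chainEnd c xs) (chainEnd d ys) (TC + concatLength xs) (TD + concatLength ys)
                        (r + length xs * (2 * z))
  close-at-ends {TC = TC} {TD} {r} [] _ _ _ close = close-mono (m≤m+n TC 0) (m≤m+n TD 0) (m≤m+n r 0) close
  close-at-ends {TC = TC} {TD} {r} {x@(seg _ _ _ _) ∷ xs} {y@(seg _ _ _ _) ∷ ys} (refl ∷ same) runC runD budget close =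
    close-mono (≤-reflexive (concatLength-∷ TC x xs)) (≤-reflexive (concatLength-∷ TD y ys)) (≤-reflexive r-assoc)
      (close-at-ends same (runner-next runC) (runner-next runD) (≤-trans (≤-reflexive (cong (δ +_) r-assoc)) budget)
        (close-across runC runD (≤-trans (+-monoʳ-≤ δ (m≤m+n r _)) budget) close))
    where
    r-assoc : r + 2 * z + length xs * (2 * z) ≡ r + (2 * z + length xs * (2 * z))
    r-assoc = +-assoc r (2 * z) (length xs * (2 * z))

  runner-from-start : ∀ {xs} → Chained s xs → All (WellFormed P z Λ) xs →
                      AlmostShortest δ (walk s (concatSteps xs)) → Runner s 0 xs
  runner-from-start {xs} chained wfs almost =
    runner chained wfs reach-refl
      (subst (λ v → AlmostShortestTo v (concatLength xs)) (lastOf-concatSteps s xs chained)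
             (almostShortest⇒To {walk s (concatSteps xs)} refl almost))

  reach-between-ends : ∀ {xs ys γ} → Pointwise SameType xs ys → Chained s xs → Chained s ys →
    All (WellFormed P z Λ) xs → All (WellFormed P z Λ) ys →
    AlmostShortest δ (walk s (concatSteps xs)) → AlmostShortest δ (walk s (concatSteps ys)) →
    ∣ concatLength xs - concatLength ys ∣ ≤ γ → δ + length xs * (2 * z) ≤ Λ + Λ →
    Reach (lastOf {G} s (concatSteps xs)) (lastOf {G} s (concatSteps ys)) (γ + length xs * (2 * z) + δ)
  reach-between-ends {xs} {ys} same chainedC chainedD wfsC wfsD almostC almostD diff budget =
    subst₂ (λ u v → Reach u v _) (≡.sym (lastOf-concatSteps s xs chainedC)) (≡.sym (lastOf-concatSteps s ys chainedD))
      (close-short (close-at-ends same runC runD budget (inj₁ (via reach-refl reach-refl z≤n)))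
                   (Runner.finish runC) (Runner.finish runD) diff)
    where
    runC : Runner s 0 xs
    runC = runner-from-start chainedC wfsC almostC
    runD : Runner s 0 ys
    runD = runner-from-start chainedD wfsD almostD

subpathDir⇒subpath : ∀ {G} b {U W : Walk G} → SubpathDir b U W → Subpath U W
subpathDir⇒subpath true  = inj₁
subpathDir⇒subpath false = inj₂

module _ {G : Graph} {k ρ : ℕ} {P : Fin k → Walk G} {ℓ : ℕ} where

  snappath-tail : ∀ {R₀′ x xs} → IsSnappath G k ρ P ℓ (snap R₀′ (x ∷ xs)) → IsSnappath G k ρ P ℓ (snap (R x) xs)
  snappath-tail (_ , _ , (_ , _ , chained) , ((_ , Rw , _ , R-short , _) , rest) , _ ∷ pairs) =
    Rw , R-short , chained , rest , pairs

  segments-wellFormed : ∀ {R₀′ xs} → IsSnappath G k ρ P ℓ (snap R₀′ xs) →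
                        All (WellFormed P (rhoSeq k ρ ℓ) ((2 * k + 3) * rhoSeq k ρ ℓ)) xs
  segments-wellFormed {xs = []}    _ = []
  segments-wellFormed {xs = _ ∷ _} isC@(_ , _ , _ , ((Qw , Rw , on-P , R-short , Q-long) , _) , _) =
    wellFormed Qw Rw on-P R-short Q-long ∷ segments-wellFormed (snappath-tail isC)

  distinct-indices : ∀ {z Λ xs} → All (WellFormed P z Λ) xs →
    AllPairs (λ x y → ∀ p → ¬ (Subpath (Q x) (P p) × Subpath (Q y) (P p))) xs →
    AllPairs (λ x y → idx x ≢ idx y) xs
  distinct-indices []         []               = []
  distinct-indices (wx ∷ wxs) (apart ∷ aparts) =
    All.zipWith (λ (wy , x-apart-y) → different wx wy x-apart-y) (wxs , apart) ∷ distinct-indices wxs aparts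
    where
    different : ∀ {z Λ x y} → WellFormed P z Λ x → WellFormed P z Λ y →
                (∀ p → ¬ (Subpath (Q x) (P p) × Subpath (Q y) (P p))) → idx x ≢ idx y
    different {x = x} {y} wx wy x-apart-y idx≡ =
      x-apart-y (idx x) ( subpathDir⇒subpath (fwd x) (WellFormed.Q-on-P wx)
                        , subst (λ i → Subpath (Q y) (P i)) (≡.sym idx≡) (subpathDir⇒subpath (fwd y) (WellFormed.Q-on-P wy)))

  numGeod≤k : ∀ {C} → IsSnappath G k ρ P ℓ C → numGeod C ≤ k
  numGeod≤k {C@(snap _ _)} isC@(_ , _ , _ , _ , aparts) =
    subst (_≤ k) (length-map idx (segs C))
      (injective⇒≤ (lookup-injective (AllPairs.map⁺ (distinct-indices (segments-wellFormed isC) aparts))))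

2*ρ≤rhoSeq : ∀ k ρ ℓ → 2 * ρ ≤ rhoSeq k ρ ℓ
2*ρ≤rhoSeq k ρ zero    = m≤m+n (2 * ρ) 1
2*ρ≤rhoSeq k ρ (suc ℓ) =
  ≤-trans (2*ρ≤rhoSeq k ρ ℓ) (≤-trans (m≤m+n x ((2 * k + 4) * x)) (≤-reflexive (split k x)))
  where
  x : ℕ
  x = rhoSeq k ρ ℓ
  split : ∀ k x → x + (2 * k + 4) * x ≡ (2 * k + 5) * x
  split = solve-∀

slack-spent : ∀ {k k′} ρ x → k′ ≤ k →
  4 * k * ρ + 2 * x + 2 * (k ∸ k′) * x + k′ * (2 * x) ≡ 4 * k * ρ + 2 * x + 2 * k * x
slack-spent {k} {k′} ρ x k′≤k =
  ≡.trans (regroup k ρ x (k ∸ k′) k′) (cong (λ m → 4 * k * ρ + 2 * x + 2 * m * x) (m∸n+n≡m k′≤k))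
  where
  regroup : ∀ k ρ x j k′ → 4 * k * ρ + 2 * x + 2 * j * x + k′ * (2 * x) ≡ 4 * k * ρ + 2 * x + 2 * (j + k′) * x
  regroup = solve-∀

slack-spent-≤ : ∀ k ρ x → 2 * ρ ≤ x → 4 * k * ρ + 2 * x + 2 * k * x ≤ (2 * k + 3) * x + (2 * k + 3) * x
slack-spent-≤ k ρ x 2ρ≤x = begin
  4 * k * ρ + 2 * x + 2 * k * x           ≡⟨ regroup₁ k ρ x ⟩
  2 * k * (2 * ρ) + (2 * x + 2 * k * x)   ≤⟨ +-monoˡ-≤ (2 * x + 2 * k * x) (*-monoʳ-≤ (2 * k) 2ρ≤x) ⟩
  2 * k * x + (2 * x + 2 * k * x)         ≤⟨ m≤m+n _ (4 * x) ⟩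
  2 * k * x + (2 * x + 2 * k * x) + 4 * x ≡⟨ regroup₂ k x ⟩
  (2 * k + 3) * x + (2 * k + 3) * x       ∎
  where
  open ≤-Reasoning
  regroup₁ : ∀ k ρ x → 4 * k * ρ + 2 * x + 2 * k * x ≡ 2 * k * (2 * ρ) + (2 * x + 2 * k * x)
  regroup₁ = solve-∀
  regroup₂ : ∀ k x → 2 * k * x + (2 * x + 2 * k * x) + 4 * x ≡ (2 * k + 3) * x + (2 * k + 3) * x
  regroup₂ = solve-∀

final-bound : ∀ {k k′} ρ x γ .{{_ : NonZero k}} → k′ ≤ k →
  γ + k′ * (2 * x) + (4 * k * ρ + 2 * x + 2 * (k ∸ k′) * x) ≤
  γ + k * (4 * k * ρ + 2 * x + 2 * k * x) + k * (4 * x)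
final-bound {k} {k′} ρ x γ k′≤k = begin
  γ + k′ * (2 * x) + δ          ≡⟨ +-assoc γ _ δ ⟩
  γ + (k′ * (2 * x) + δ)        ≡⟨ cong (γ +_) (+-comm (k′ * (2 * x)) δ) ⟩
  γ + (δ + k′ * (2 * x))        ≡⟨ cong (γ +_) (slack-spent ρ x k′≤k) ⟩
  γ + B                         ≤⟨ +-monoʳ-≤ γ (m≤n*m B k) ⟩
  γ + k * B                     ≤⟨ m≤m+n (γ + k * B) (k * (4 * x)) ⟩
  γ + k * B + k * (4 * x)       ∎
  where
  open ≤-Reasoning
  δ B : ℕ
  δ = 4 * k * ρ + 2 * x + 2 * (k ∸ k′) * x
  B = 4 * k * ρ + 2 * x + 2 * k * x

lemma4p2 : (G : Graph) (k ρ : ℕ) (P : Fin k → Walk G) →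
  IsGeodesicCover G k ρ P →
  (ℓ : ℕ) → ℓ ≤ k →
  (C D : Snappath G k) →
  IsSnappath G k ρ P ℓ C → IsSnappath G k ρ P ℓ D →
  start (concatW C) ≡ start (concatW D) →
  len (R₀ C) ≡ 0 → len (R₀ D) ≡ 0 →
  typeOf C ≡ typeOf D →
  (γ : ℕ) → ∣ len (concatW C) - len (concatW D) ∣ ≤ γ →
  AlmostShortest (4 * k * ρ + 2 * rhoSeq k ρ ℓ + 2 * (k ∸ numGeod C) * rhoSeq k ρ ℓ) (concatW C) →
  AlmostShortest (4 * k * ρ + 2 * rhoSeq k ρ ℓ + 2 * (k ∸ numGeod C) * rhoSeq k ρ ℓ) (concatW D) →
  ∀ d → IsDist {G} (end (concatW C)) (end (concatW D)) d →
  d ≤ γ + k * (4 * k * ρ + 2 * rhoSeq k ρ ℓ + 2 * k * rhoSeq k ρ ℓ) + k * (4 * rhoSeq k ρ ℓ)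
lemma4p2 G k ρ P (geodesic , _) ℓ _ (snap (walk s []) xs@(x ∷ _)) (snap (walk _ []) ys)
         isC@(_ , _ , chainedC , _) isD@(_ , _ , chainedD , _) refl refl refl sameTypes γ diff almostC almostD _ isDist =
  ≤-trans (Walks.dist-≤ {G} isDist
            (reach-between-ends same chainedC chainedD (segments-wellFormed isC) (segments-wellFormed isD)
                                almostC almostD diff budget))
          (final-bound ρ ρℓ γ {{nonZeroIndex (idx x)}} (numGeod≤k isC))
  where
  ρℓ δ Λ : ℕ
  ρℓ = rhoSeq k ρ ℓ
  δ  = 4 * k * ρ + 2 * ρℓ + 2 * (k ∸ length xs) * ρℓ
  Λ  = (2 * k + 3) * ρℓ
  open Traversal P geodesic ρℓ Λ s δ
  type : Segment G k → Fin k × Bool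
  type y = idx y , fwd y
  same : Pointwise SameType xs ys
  same = Pointwise.map⁻ type type (Pointwise.≡⇒Pointwise-≡ sameTypes)
  budget : δ + length xs * (2 * ρℓ) ≤ Λ + Λ
  budget = ≤-trans (≤-reflexive (slack-spent ρ ρℓ (numGeod≤k isC))) (slack-spent-≤ k ρ ρℓ (2*ρ≤rhoSeq k ρ ℓ))
lemma4p2 G k ρ P _ ℓ _ (snap (walk _ (_ ∷ _)) _) _ _ _ _ () _ _ _ _ _ _ _ _
lemma4p2 G k ρ P _ ℓ _ (snap (walk _ []) _) (snap (walk _ (_ ∷ _)) _) _ _ _ _ () _ _ _ _ _ _ _
lemma4p2 G k ρ P _ ℓ _ (snap (walk _ []) []) (snap (walk _ []) []) _ _ refl _ _ _ _ _ _ _ _ isDist =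
  ≤-trans (Walks.dist-≤ {G} isDist Walks.reach-refl) z≤n
lemma4p2 G k ρ P _ ℓ _ (snap (walk _ []) []) (snap (walk _ []) (_ ∷ _)) _ _ _ _ _ () _ _ _ _ _ _
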